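{- For all integers $1\leq \ell<k/2$, the graph $H_{\ell,k}$ is reflective.
   Context: $H_{\ell,k}$ is the bipartite graph whose parts are $[k]^{(\ell)}$ and $[k]^{(k-\ell)}$ (the $\ell$-element and $(k-\ell)$-element subsets of $[k]=\{1,\dots,k\}$), with $S\in[k]^{(\ell)}$ adjacent to $T\in[k]^{(k-\ell)}$ iff $S\subset T$. For an automorphism $\phi$ of a graph $H$ let $F_\phi=\{v\in V(H):\phi(v)=v\}$. For a connected bipartite graph $H$, a triple $(A,B,\phi)$ with $A,B\subset V(H)$ and $\phi$ an automorphism of $H$ is nice if $\phi=\phi^{ -1}$; $A$, $B$, $F_\phi$ partition $V(H)$; $F_\phi$ separates $A$ from $B$ (no edge of $H$ joins $A$ and $B$); and $\phi(A)=B$. A set $R\subset V(H)$ is admissible for $(A,B,\phi)$ if all vertices of $R$ lie in the same part of the bipartition of $H$ and $R$ intersects both $A\cup F_\phi$ and $B\cup F_\phi$. Define $\psi_{A,B,\phi}(R)=(R\cap(A\cup F_\phi))\cup\phi(R\cap A)$. A connected bipartite graph $H$ with parts $X_1,X_2$ is reflective if for every $i\in\{1,2\}$ and every $R\subset X_i$ with $|R|=2$ there exist nice triples $(A_j,B_j,\phi_j)$, $j=0,\dots,m-1$, and sets $R_0,\dots,R_m$ with $R_j$ admissible for $(A_j,B_j,\phi_j)$, $R_0=R$, $R_m=X_i$ and $R_{j+1}=\psi_{A_j,B_j,\phi_j}(R_j)$ for all $0\leq j\leq m-1$. -}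

module Defs where

open import Level using (Level)
open import Data.Nat using (ℕ; _∸_)
open import Data.Fin using (Fin; zero; suc)
open import Data.Fin.Subset using (Subset; _⊆_; ∣_∣)
open import Data.Sum using (_⊎_; inj₁; inj₂)
open import Data.Product using (Σ; ∃; _×_; _,_)
open import Data.Empty using (⊥)
open import Relation.Nullary using (¬_)
open import Relation.Binary.PropositionalEquality using (_≡_)

-- Generic graphs with a given bipartition (parts indexed by Fin 2:
-- zero = X₁, suc zero = X₂).  Vertex sets are predicates on V.

record BipGraph : Set₁ where
  field
    V    : Set
    E    : V → V → Set
    part : V → Fin 2

Pred : Set → Set₁
Pred V = V → Set

_≐_ : {V : Set} → Pred V → Pred V → Set
R ≐ S = ∀ v → (R v → S v) × (S v → R v)

module _ (G : BipGraph) where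
  open BipGraph G

  Part : Fin 2 → Pred V
  Part i v = part v ≡ i

  data Walk : V → V → Set where
    here  : ∀ {v} → Walk v v
    there : ∀ {u w v} → E u w → Walk w v → Walk u v

  Connected : Set
  Connected = ∀ u v → Walk u v

  Fix : (V → V) → Pred V
  Fix φ v = φ v ≡ v

  Img : (V → V) → Pred V → Pred V
  Img φ R v = ∃ λ u → R u × φ u ≡ v

  record Nice (A B : Pred V) (φ : V → V) : Set where
    field
      involutive : ∀ v → φ (φ v) ≡ v
      preservesE : ∀ u v → (E u v → E (φ u) (φ v)) × (E (φ u) (φ v) → E u v)
      cover      : ∀ v → A v ⊎ (B v ⊎ Fix φ v)
      disjAB     : ∀ v → A v → B v → ⊥
      disjAF     : ∀ v → A v → Fix φ v → ⊥
      disjBF     : ∀ v → B v → Fix φ v → ⊥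
      separates  : ∀ u v → A u → B v → ¬ E u v
      imageAB    : Img φ A ≐ B

  record Admissible (A B : Pred V) (φ : V → V) (R : Pred V) : Set where
    field
      samePart : Σ (Fin 2) λ i → ∀ v → R v → Part i v
      meetsAF  : ∃ λ v → R v × (A v ⊎ Fix φ v)
      meetsBF  : ∃ λ v → R v × (B v ⊎ Fix φ v)

  ψ : Pred V → Pred V → (V → V) → Pred V → Pred V
  ψ A B φ R v = (R v × (A v ⊎ Fix φ v)) ⊎ Img φ (λ u → R u × A u) v

  data ReachesPart (i : Fin 2) : Pred V → Set₁ where
    done : ∀ {R} → R ≐ Part i → ReachesPart i R
    step : ∀ {R} (A B : Pred V) (φ : V → V) →
           Nice A B φ → Admissible A B φ R →
           ReachesPart i (ψ A B φ R) → ReachesPart i R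

  Pair : V → V → Pred V
  Pair x y v = (v ≡ x) ⊎ (v ≡ y)

  Reflective : Set₁
  Reflective = Connected ×
    (∀ (i : Fin 2) (x y : V) → Part i x → Part i y → ¬ (x ≡ y) →
       ReachesPart i (Pair x y))

record KSet (k r : ℕ) : Set where
  constructor kset
  field
    set    : Subset k
    .card  : ∣ set ∣ ≡ r
open KSet public

HVert : ℕ → ℕ → Set
HVert ℓ k = KSet k ℓ ⊎ KSet k (k ∸ ℓ)

HAdj : (ℓ k : ℕ) → HVert ℓ k → HVert ℓ k → Set
HAdj ℓ k (inj₁ S) (inj₂ T) = set S ⊆ set T
HAdj ℓ k (inj₂ T) (inj₁ S) = set S ⊆ set T
HAdj ℓ k (inj₁ _) (inj₁ _) = ⊥
HAdj ℓ k (inj₂ _) (inj₂ _) = ⊥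

HPart : (ℓ k : ℕ) → HVert ℓ k → Fin 2
HPart ℓ k (inj₁ _) = zero
HPart ℓ k (inj₂ _) = suc zero

H : ℕ → ℕ → BipGraph
H ℓ k = record { V = HVert ℓ k ; E = HAdj ℓ k ; part = HPart ℓ k }

module Submission where

-- A transposition (a b) of [k] acts on H ℓ k as an automorphism, and with the sets having
-- a ↦ z, b ↦ not z, respectively a ↦ not z, b ↦ z, it forms a nice triple; a ψ-move thus
-- replaces members of a family by their images under (a b).  For distinct r-sets s, t, one
-- move with a ∈ s ∖ t, b ∈ t ∖ s turns {s, t} into {s, (a b) s}, the r-sets agreeing with s
-- outside {a, b}.  The family of r-sets agreeing with s outside a set X ∋ a, b grows to the
-- family for X ∪ {c} by moves in the transpositions (c x), x ∈ X; freeing all coordinates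
-- gives all r-sets.  Connectivity follows from the same sequence: the ℓ-sets joined to a fixed
-- one by walks are closed under the moves, since for 2ℓ < k a set and its image under a
-- transposition lie in a common (k − ℓ)-set.

open import Defs
open import Data.Bool using (Bool; true; false; not)
open import Data.Bool.Properties using (not-¬; ¬-not; not-involutive) renaming (_≟_ to _≟ᵇ_)
open import Data.Empty using (⊥; ⊥-elim)
open import Data.Fin using (Fin; zero; suc) renaming (_≟_ to _≟ᶠ_)
open import Data.Fin.Subset using (Subset; ∣_∣)
import Data.Fin.Subset as Sub
import Data.Fin.Subset.Properties as Subₚ
open import Data.Fin.Properties using (¬∀⟶∃¬)
open import Data.Nat using (ℕ; suc; _+_; _*_; _∸_; _≤_; _<_; z≤n; s≤s; _≤?_) renaming (_≟_ to _≟ⁿ_)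
open import Data.Nat.Properties
  using (<-irrefl; +-suc; +-comm; +-identityʳ; +-cancelʳ-≡; n≤0⇒n≡0; ≤-antisym; ≰⇒>; ≤-trans; <⇒≤;
         m∸n≤m; m+n≤o⇒m≤o∸n)
open import Data.Product using (Σ; ∃; _×_; _,_; proj₁; proj₂)
open import Data.Sum using (_⊎_; inj₁; inj₂; [_,_]′)
import Data.Sum as Sum
import Data.Vec as Vec
open import Data.Vec using (Vec; []; _∷_; [_]; lookup; _[_]≔_; tabulate; replicate)
open import Data.Vec.Properties
  using (lookup∘update; lookup∘update′; tabulate∘lookup; tabulate-cong; lookup-replicate;
         []=⇒lookup; lookup⇒[]=)
open import Relation.Nullary using (¬_; yes; no)
open import Relation.Nullary.Decidable using (_⊎-dec_; recompute)
open import Relation.Unary using (_⊆_; _∪_; _∩_; ｛_｝; Satisfiable)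
open import Data.List using (List; []; _∷_; _++_; allFin)
open import Data.List.Membership.Propositional using (_∈_; _∉_)
open import Data.List.Membership.Propositional.Properties using (∈-++⁺ˡ; ∈-++⁺ʳ; ∈-allFin)

open import Data.List.Relation.Unary.Any using (here; there; any?)
open import Function using (id; _∘_)
open import Relation.Binary.PropositionalEquality
  using (_≡_; _≢_; refl; sym; trans; cong; subst; subst₂; module ≡-Reasoning)

lookup-ext : ∀ {A : Set} {n} {u v : Vec A n} → (∀ i → lookup u i ≡ lookup v i) → u ≡ v
lookup-ext {u = u} {v} eq = begin
  u                   ≡⟨ tabulate∘lookup u ⟨
  tabulate (lookup u) ≡⟨ tabulate-cong eq ⟩
  tabulate (lookup v) ≡⟨ tabulate∘lookup v ⟩
  v                   ∎
  where open ≡-Reasoning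

⊆-from-lookup : ∀ {n} {s t : Subset n} → (∀ i → lookup s i ≡ true → lookup t i ≡ true) → s Sub.⊆ t
⊆-from-lookup {t = t} h {i} i∈s = lookup⇒[]= i t (h i ([]=⇒lookup i∈s))

⊆-to-lookup : ∀ {n} {s t : Subset n} → s Sub.⊆ t → ∀ i → lookup s i ≡ true → lookup t i ≡ true
⊆-to-lookup {s = s} s⊆t i si = []=⇒lookup (s⊆t (lookup⇒[]= i s si))

-- ∣ [ x ] ∣ is 1 or 0 according as x is true or false.
∣update∣ : ∀ {n} (u : Subset n) i x → ∣ u [ i ]≔ x ∣ + ∣ [ lookup u i ] ∣ ≡ ∣ u ∣ + ∣ [ x ] ∣
∣update∣ (true  ∷ u) zero    true  = refl
∣update∣ (true  ∷ u) zero    false = +-suc ∣ u ∣ 0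
∣update∣ (false ∷ u) zero    true  = sym (+-suc ∣ u ∣ 0)
∣update∣ (false ∷ u) zero    false = refl
∣update∣ (true  ∷ u) (suc i) x     = cong suc (∣update∣ u i x)
∣update∣ (false ∷ u) (suc i) x     = ∣update∣ u i x

lookup-⊂⇒∣∣< : ∀ {n} (p q : Subset n) → (∀ i → lookup p i ≡ true → lookup q i ≡ true) →
               ∀ c → lookup p c ≡ false → lookup q c ≡ true → ∣ p ∣ < ∣ q ∣
lookup-⊂⇒∣∣< p q p⊆q c pc qc =
  Subₚ.p⊂q⇒∣p∣<∣q∣ {p = p} {q}
    (⊆-from-lookup p⊆q , c , lookup⇒[]= c q qc , λ c∈p → not-¬ pc ([]=⇒lookup c∈p))

ChangesOnlyTo : ∀ {n} → Bool → Subset n → Subset n → Set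
ChangesOnlyTo x u w = ∀ i → lookup u i ≡ lookup w i ⊎ lookup u i ≡ x

changes-only-to⇒∣∣≢ : ∀ {n} x {u w : Subset n} → ChangesOnlyTo x u w →
                      ∀ c → lookup u c ≢ lookup w c → ∣ u ∣ ≢ ∣ w ∣
changes-only-to⇒∣∣≢ false {u} {w} changes c uc≢wc eq = <-irrefl eq (lookup-⊂⇒∣∣< u w shrink c uc wc)
  where
  uc : lookup u c ≡ false
  uc = [ (λ uc≡wc → ⊥-elim (uc≢wc uc≡wc)) , id ]′ (changes c)
  wc : lookup w c ≡ true
  wc = ¬-not λ wc≡f → uc≢wc (trans uc (sym wc≡f))
  shrink : ∀ i → lookup u i ≡ true → lookup w i ≡ true
  shrink i ui =
    [ (λ ui≡wi → trans (sym ui≡wi) ui) , (λ ui≡f → ⊥-elim (not-¬ ui ui≡f)) ]′ (changes i)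
changes-only-to⇒∣∣≢ true {u} {w} changes c uc≢wc eq =
  <-irrefl (sym eq) (lookup-⊂⇒∣∣< w u grow c wc uc)
  where
  uc : lookup u c ≡ true
  uc = [ (λ uc≡wc → ⊥-elim (uc≢wc uc≡wc)) , id ]′ (changes c)
  wc : lookup w c ≡ false
  wc = ¬-not λ wc≡t → uc≢wc (trans uc (sym wc≡t))
  grow : ∀ i → lookup w i ≡ true → lookup u i ≡ true
  grow i wi = [ (λ ui≡wi → trans ui≡wi wi) , id ]′ (changes i)

swap : ∀ {n} → Fin n → Fin n → Subset n → Subset n
swap a b u = (u [ a ]≔ lookup u b) [ b ]≔ lookup u a

data Position {n} (a b : Fin n) : Fin n → Set where
  at-a      : Position a b a
  at-b      : Position a b b
  elsewhere : ∀ {i} → i ≢ a → i ≢ b → Position a b i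

position : ∀ {n} (a b i : Fin n) → Position a b i
position a b i with i ≟ᶠ a | i ≟ᶠ b
... | yes refl | _        = at-a
... | no _     | yes refl = at-b
... | no i≢a   | no i≢b   = elsewhere i≢a i≢b

module _ {n} (a b : Fin n) where

  lookup-swap-b : ∀ (u : Subset n) → lookup (swap a b u) b ≡ lookup u a
  lookup-swap-b u = lookup∘update b (u [ a ]≔ lookup u b) (lookup u a)

  lookup-swap-a : ∀ (u : Subset n) → lookup (swap a b u) a ≡ lookup u b
  lookup-swap-a u with a ≟ᶠ b
  ... | yes refl = lookup-swap-b u
  ... | no a≢b   = trans (lookup∘update′ a≢b (u [ a ]≔ lookup u b) (lookup u a))
                         (lookup∘update a u (lookup u b))

  lookup-swap-≢ : ∀ (u : Subset n) {i} → i ≢ a → i ≢ b → lookup (swap a b u) i ≡ lookup u i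
  lookup-swap-≢ u i≢a i≢b = trans (lookup∘update′ i≢b (u [ a ]≔ lookup u b) (lookup u a))
                                  (lookup∘update′ i≢a u (lookup u b))

  swap-involutive : ∀ (u : Subset n) → swap a b (swap a b u) ≡ u
  swap-involutive u = lookup-ext λ i → at (position a b i)
    where
    at : ∀ {i} → Position a b i → lookup (swap a b (swap a b u)) i ≡ lookup u i
    at at-a                = trans (lookup-swap-a (swap a b u)) (lookup-swap-b u)
    at at-b                = trans (lookup-swap-b (swap a b u)) (lookup-swap-a u)
    at (elsewhere i≢a i≢b) = trans (lookup-swap-≢ (swap a b u) i≢a i≢b) (lookup-swap-≢ u i≢a i≢b)

  balanced⇒swap-fixed : ∀ (u : Subset n) → lookup u a ≡ lookup u b → swap a b u ≡ u
  balanced⇒swap-fixed u ua≡ub = lookup-ext λ i → at (position a b i)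
    where
    at : ∀ {i} → Position a b i → lookup (swap a b u) i ≡ lookup u i
    at at-a                = trans (lookup-swap-a u) (sym ua≡ub)
    at at-b                = trans (lookup-swap-b u) ua≡ub
    at (elsewhere i≢a i≢b) = lookup-swap-≢ u i≢a i≢b

  swap-fixed⇒balanced : ∀ (u : Subset n) → swap a b u ≡ u → lookup u a ≡ lookup u b
  swap-fixed⇒balanced u fixed = trans (cong (λ v → lookup v a) (sym fixed)) (lookup-swap-a u)

  ∣swap∣ : ∀ (u : Subset n) → ∣ swap a b u ∣ ≡ ∣ u ∣
  ∣swap∣ u = +-cancelʳ-≡ _ _ _ (begin
    ∣ swap a b u ∣ + ∣ [ lookup u b ] ∣   ≡⟨ cong (λ x → ∣ swap a b u ∣ + ∣ [ x ] ∣) u′b≡ub ⟨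
    ∣ swap a b u ∣ + ∣ [ lookup u′ b ] ∣  ≡⟨ ∣update∣ u′ b (lookup u a) ⟩
    ∣ u′ ∣ + ∣ [ lookup u a ] ∣          ≡⟨ ∣update∣ u a (lookup u b) ⟩
    ∣ u ∣ + ∣ [ lookup u b ] ∣           ∎)
    where
    open ≡-Reasoning
    u′ = u [ a ]≔ lookup u b
    u′b≡ub : lookup u′ b ≡ lookup u b
    u′b≡ub with b ≟ᶠ a
    ... | yes refl = lookup∘update a u (lookup u b)
    ... | no b≢a   = lookup∘update′ b≢a u (lookup u b)

swap-comm : ∀ {n} (a b : Fin n) (u : Subset n) → swap a b u ≡ swap b a u
swap-comm a b u = lookup-ext λ i → at (position a b i)
  where
  at : ∀ {i} → Position a b i → lookup (swap a b u) i ≡ lookup (swap b a u) i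
  at at-a                = trans (lookup-swap-a a b u) (sym (lookup-swap-b b a u))
  at at-b                = trans (lookup-swap-b a b u) (sym (lookup-swap-a b a u))
  at (elsewhere i≢a i≢b) = trans (lookup-swap-≢ a b u i≢a i≢b) (sym (lookup-swap-≢ b a u i≢b i≢a))

swap-preserves-⊆ : ∀ {n} (a b : Fin n) {s t : Subset n} → s Sub.⊆ t → swap a b s Sub.⊆ swap a b t
swap-preserves-⊆ a b {s} {t} s⊆t = ⊆-from-lookup λ i → at (position a b i)
  where
  s⊆ᵗt = ⊆-to-lookup s⊆t
  at : ∀ {i} → Position a b i → lookup (swap a b s) i ≡ true → lookup (swap a b t) i ≡ true
  at at-a si = trans (lookup-swap-a a b t) (s⊆ᵗt b (trans (sym (lookup-swap-a a b s)) si))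
  at at-b si = trans (lookup-swap-b a b t) (s⊆ᵗt a (trans (sym (lookup-swap-b a b s)) si))
  at {i} (elsewhere i≢a i≢b) si =
    trans (lookup-swap-≢ a b t i≢a i≢b) (s⊆ᵗt i (trans (sym (lookup-swap-≢ a b s i≢a i≢b)) si))

swap-reflects-⊆ : ∀ {n} (a b : Fin n) {s t : Subset n} → swap a b s Sub.⊆ swap a b t → s Sub.⊆ t
swap-reflects-⊆ a b {s} {t} h =
  subst₂ Sub._⊆_ (swap-involutive a b s) (swap-involutive a b t) (swap-preserves-⊆ a b h)

sandwich : ∀ {n} {u w : Subset n} m → u Sub.⊆ w → ∣ u ∣ ≤ m → m ≤ ∣ w ∣ →
           ∃ λ v → u Sub.⊆ v × v Sub.⊆ w × ∣ v ∣ ≡ m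
sandwich {u = []}        {[]}        m       _   _        m≤0      = [] , id , id , sym (n≤0⇒n≡0 m≤0)
sandwich {u = false ∷ u} {false ∷ w} m       u⊆w lo       hi       =
  let v , u⊆v , v⊆w , ∣v∣ = sandwich m (Subₚ.drop-∷-⊆ u⊆w) lo hi
  in false ∷ v , Subₚ.s⊆s u⊆v , Subₚ.s⊆s v⊆w , ∣v∣
sandwich {u = true ∷ u}  {true ∷ w}  (suc m) u⊆w (s≤s lo) (s≤s hi) =
  let v , u⊆v , v⊆w , ∣v∣ = sandwich m (Subₚ.drop-∷-⊆ u⊆w) lo hi
  in true ∷ v , Subₚ.s⊆s u⊆v , Subₚ.s⊆s v⊆w , cong suc ∣v∣
sandwich {u = true ∷ u}  {false ∷ w} m       u⊆w _        _        with u⊆w Vec.here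
... | ()
sandwich {u = false ∷ u} {true ∷ w}  m       u⊆w lo       hi       with m ≤? ∣ w ∣
... | yes m≤∣w∣ = let v , u⊆v , v⊆w , ∣v∣ = sandwich m (Subₚ.drop-∷-⊆ u⊆w) lo m≤∣w∣
                  in false ∷ v , Subₚ.s⊆s u⊆v , Subₚ.out⊆ v⊆w , ∣v∣
... | no m≰∣w∣  = true ∷ w , Subₚ.out⊆ (Subₚ.drop-∷-⊆ u⊆w) , id , ≤-antisym (≰⇒> m≰∣w∣) hi

∃-lookup : ∀ {n} z (u : Subset n) → u ≢ replicate n (not z) → ∃ λ i → lookup u i ≡ z
∃-lookup {n} z u u≢const
  with ¬∀⟶∃¬ n (λ i → lookup u i ≡ not z) (λ i → lookup u i ≟ᵇ not z)
             (λ const → u≢const (lookup-ext λ i → trans (const i) (sym (lookup-replicate i (not z)))))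
... | i , ui≢¬z = i , trans (¬-not ui≢¬z) (not-involutive z)

∃-member : ∀ {n} (u : Subset n) → 0 < ∣ u ∣ → ∃ λ i → lookup u i ≡ true
∃-member {n} u 0<∣u∣ =
  ∃-lookup true u λ u≡⊥ → <-irrefl (sym (trans (cong ∣_∣ u≡⊥) (Subₚ.∣⊥∣≡0 n))) 0<∣u∣

∃-non-member : ∀ {n} (u : Subset n) → ∣ u ∣ < n → ∃ λ i → lookup u i ≡ false
∃-non-member {n} u ∣u∣<n =
  ∃-lookup false u λ u≡⊤ → <-irrefl (trans (cong ∣_∣ u≡⊤) (Subₚ.∣⊤∣≡n n)) ∣u∣<n

insert-⊇ : ∀ {n} (u : Subset n) b → u Sub.⊆ u [ b ]≔ true
insert-⊇ u b = ⊆-from-lookup λ i ui → at i ui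
  where
  at : ∀ i → lookup u i ≡ true → lookup (u [ b ]≔ true) i ≡ true
  at i ui with i ≟ᶠ b
  ... | yes refl = lookup∘update i u true
  ... | no i≢b   = trans (lookup∘update′ i≢b u true) ui

insert-⊇-swap : ∀ {n} {u : Subset n} a b → lookup u a ≡ true → swap a b u Sub.⊆ u [ b ]≔ true
insert-⊇-swap {u = u} a b ua = ⊆-from-lookup λ i → at (position a b i)
  where
  kept = ⊆-to-lookup (insert-⊇ u b)
  at : ∀ {i} → Position a b i → lookup (swap a b u) i ≡ true → lookup (u [ b ]≔ true) i ≡ true
  at at-a                _  = kept a ua
  at at-b                _  = lookup∘update b u true
  at (elsewhere i≢a i≢b) si = kept _ (trans (sym (lookup-swap-≢ a b u i≢a i≢b)) si)

∣insert∣ : ∀ {n} (u : Subset n) {b} → lookup u b ≡ false → ∣ u [ b ]≔ true ∣ ≡ suc ∣ u ∣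
∣insert∣ u {b} ub = begin
  ∣ u [ b ]≔ true ∣                      ≡⟨ +-identityʳ _ ⟨
  ∣ u [ b ]≔ true ∣ + ∣ [ false ] ∣      ≡⟨ cong (λ x → ∣ u [ b ]≔ true ∣ + ∣ [ x ] ∣) ub ⟨
  ∣ u [ b ]≔ true ∣ + ∣ [ lookup u b ] ∣ ≡⟨ ∣update∣ u b true ⟩
  ∣ u ∣ + 1                              ≡⟨ +-comm ∣ u ∣ 1 ⟩
  suc ∣ u ∣                              ∎
  where open ≡-Reasoning

record Side {n} (a b : Fin n) (z : Bool) (u : Subset n) : Set where
  constructor sided
  field
    lookup-a : lookup u a ≡ z
    lookup-b : lookup u b ≡ not z

Balanced : ∀ {n} → Fin n → Fin n → Pred (Subset n)
Balanced a b u = lookup u a ≡ lookup u b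

side-trichotomy : ∀ {n} (a b : Fin n) z u → Side a b z u ⊎ Side b a z u ⊎ Balanced a b u
side-trichotomy a b z u with lookup u a ≟ᵇ z | lookup u b ≟ᵇ z
... | yes ua≡z | yes ub≡z = inj₂ (inj₂ (trans ua≡z (sym ub≡z)))
... | yes ua≡z | no ub≢z  = inj₁ (sided ua≡z (¬-not ub≢z))
... | no ua≢z  | yes ub≡z = inj₂ (inj₁ (sided ub≡z (¬-not ua≢z)))
... | no ua≢z  | no ub≢z  = inj₂ (inj₂ (trans (¬-not ua≢z) (sym (¬-not ub≢z))))

side-or-balanced : ∀ {n} (a b : Fin n) {z} u → lookup u a ≡ z → Side a b z u ⊎ Balanced a b u
side-or-balanced a b {z} u ua≡z with lookup u b ≟ᵇ z
... | yes ub≡z = inj₂ (trans ua≡z (sym ub≡z))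
... | no ub≢z  = inj₁ (sided ua≡z (¬-not ub≢z))

swap-side : ∀ {n} {a b : Fin n} {z u} → Side a b z u → Side b a z (swap a b u)
swap-side {a = a} {b} {u = u} (sided ua≡z ub≡¬z) =
  sided (trans (lookup-swap-b a b u) ua≡z) (trans (lookup-swap-a a b u) ub≡¬z)

swap-side⁻ : ∀ {n} {a b : Fin n} {z u} → Side b a z u → Side a b z (swap a b u)
swap-side⁻ {a = a} {b} {u = u} (sided ub≡z ua≡¬z) =
  sided (trans (lookup-swap-a a b u) ub≡z) (trans (lookup-swap-b a b u) ua≡¬z)

-- ψ of the nice triple (Side a b z, Side b a z, swap a b) acting on a family of sets.
Ψ : ∀ {n} → Fin n → Fin n → Bool → Pred (Subset n) → Pred (Subset n)
Ψ a b z P = (P ∩ (Side a b z ∪ Balanced a b)) ∪ (λ u → ∃ λ w → (P ∩ Side a b z) w × swap a b w ≡ u)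

data Reaches {n} (G : Pred (Subset n)) : Pred (Subset n) → Set₁ where
  done : ∀ {P} → G ⊆ P → Reaches G P
  step : ∀ {P} a b z →
         Satisfiable (P ∩ (Side a b z ∪ Balanced a b)) →
         Satisfiable (P ∩ (Side b a z ∪ Balanced a b)) →
         Reaches G (Ψ a b z P) → Reaches G P

module _ {n : ℕ} where

  Ψ-mono : ∀ a b z {P Q : Pred (Subset n)} → P ⊆ Q → Ψ a b z P ⊆ Ψ a b z Q
  Ψ-mono a b z P⊆Q (inj₁ (Pu , AF))          = inj₁ (P⊆Q Pu , AF)
  Ψ-mono a b z P⊆Q (inj₂ (w , (Pw , A) , e)) = inj₂ (w , (P⊆Q Pw , A) , e)

  reaches-mono : ∀ {G P Q : Pred (Subset n)} → Reaches G P → P ⊆ Q → Reaches G Q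
  reaches-mono (done G⊆P) P⊆Q = done (P⊆Q ∘ G⊆P)
  reaches-mono (step a b z (u , Pu , AF) (v , Pv , BF) r) P⊆Q =
    step a b z (u , P⊆Q Pu , AF) (v , P⊆Q Pv , BF) (reaches-mono r (Ψ-mono a b z P⊆Q))

  reaches-trans : ∀ {G H P : Pred (Subset n)} → Reaches H P → Reaches G H → Reaches G P
  reaches-trans (done H⊆P)          r = reaches-mono r H⊆P
  reaches-trans (step a b z A B r′) r = step a b z A B (reaches-trans r′ r)

  step-via : ∀ {G P Q : Pred (Subset n)} a b z →
             Satisfiable (P ∩ (Side a b z ∪ Balanced a b)) →
             Satisfiable (P ∩ (Side b a z ∪ Balanced a b)) →
             Q ⊆ Ψ a b z P → Reaches G Q → Reaches G P
  step-via a b z A B Q⊆ΨP r = step a b z A B (reaches-mono r Q⊆ΨP)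

  SwapClosed : Pred (Subset n) → Set
  SwapClosed Q = ∀ a b z {u} → Side a b z u → Q u → Q (swap a b u)

  reaches-⊆-closed : ∀ {G P Q : Pred (Subset n)} → Reaches G P → P ⊆ Q → SwapClosed Q → G ⊆ Q
  reaches-⊆-closed (done G⊆P)          P⊆Q closed = P⊆Q ∘ G⊆P
  reaches-⊆-closed {P = P} {Q} (step a b z _ _ r) P⊆Q closed = reaches-⊆-closed r ΨP⊆Q closed
    where
    ΨP⊆Q : Ψ a b z P ⊆ Q
    ΨP⊆Q (inj₁ (Pu , _))                = P⊆Q Pu
    ΨP⊆Q (inj₂ (w , (Pw , A) , refl)) = closed a b z A (P⊆Q Pw)

Layer : ∀ {n} → ℕ → Pred (Subset n)
Layer r u = ∣ u ∣ ≡ r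

record Variants {n} (w : Subset n) (xs : List (Fin n)) (u : Subset n) : Set where
  constructor variant
  field
    same-size : ∣ u ∣ ≡ ∣ w ∣
    agrees    : ∀ i → i ∉ xs → lookup u i ≡ lookup w i

Mixed : ∀ {n} → Subset n → List (Fin n) → Set
Mixed w xs = ∀ z → ∃ λ x → x ∈ xs × lookup w x ≡ z

module VariantsOf {n : ℕ} (w : Subset n) where

  variants-self : ∀ {xs} → Variants w xs w
  variants-self = variant refl λ _ _ → refl

  variants-mono : ∀ {xs ys} → (∀ {i} → i ∈ xs → i ∈ ys) → Variants w xs ⊆ Variants w ys
  variants-mono xs⊆ys (variant card agree) = variant card λ i i∉ys → agree i (i∉ys ∘ xs⊆ys)

  variants-swap : ∀ {xs x y u} → x ∈ xs → y ∈ xs → Variants w xs u → Variants w xs (swap x y u)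
  variants-swap {u = u} x∈xs y∈xs (variant card agree) =
    variant (trans (∣swap∣ _ _ u) card)
    λ i i∉xs → trans (lookup-swap-≢ _ _ u (λ { refl → i∉xs x∈xs }) (λ { refl → i∉xs y∈xs }))
                     (agree i i∉xs)

  variants-narrow : ∀ {c xs u} → c ∉ xs → Variants w (c ∷ xs) u → lookup u c ≡ lookup w c →
                    Variants w xs u
  variants-narrow {c} {xs} {u} c∉xs (variant card agree) uc≡wc = variant card agree′
    where
    agree′ : ∀ i → i ∉ xs → lookup u i ≡ lookup w i
    agree′ i i∉xs with i ≟ᶠ c
    ... | yes refl = uc≡wc
    ... | no i≢c   = agree i λ { (here i≡c) → i≢c i≡c ; (there i∈xs) → i∉xs i∈xs }

  mixed-witness : ∀ {xs x} → Mixed w xs → x ∈ xs → ∀ z → ∃ λ u → Variants w xs u × lookup u x ≡ z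
  mixed-witness {x = x} mixed x∈xs z with mixed z
  ... | y , y∈xs , wy≡z =
    swap x y w , variants-swap {u = w} x∈xs y∈xs variants-self , trans (lookup-swap-a x y w) wy≡z

  -- Sizes agree, so the value w c lost at c reappears inside xs.
  variants-compensate : ∀ {c xs u} → Variants w (c ∷ xs) u → lookup u c ≢ lookup w c →
                        ∃ λ x → x ∈ xs × Side x c (lookup w c) u
  variants-compensate {c} {xs} {u} (variant card agree) uc≢wc
    with ¬∀⟶∃¬ n (λ i → lookup u i ≡ lookup w i ⊎ lookup u i ≡ not (lookup w c))
               (λ i → (lookup u i ≟ᵇ lookup w i) ⊎-dec (lookup u i ≟ᵇ not (lookup w c)))
               (λ changes → changes-only-to⇒∣∣≢ _ {u} {w} changes c uc≢wc card)
  ... | i , ¬changes = i , i∈xs , sided ui≡z (¬-not uc≢wc)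
    where
    ui≡z : lookup u i ≡ lookup w c
    ui≡z = trans (¬-not (¬changes ∘ inj₂)) (not-involutive _)
    i∈xs : i ∈ xs
    i∈xs with any? (i ≟ᶠ_) xs
    ... | yes i∈xs = i∈xs
    ... | no i∉xs  =
      ⊥-elim (¬changes (inj₁ (agree i λ { (here refl) → uc≢wc ui≡z ; (there i∈xs) → i∉xs i∈xs })))

-- Freeing one more coordinate c ∉ xs: for each x ∈ xs in turn, the reflection in the
-- transposition (c x) adds the variants that moved the value w c from c to x.
module Grow {n : ℕ} (w : Subset n) {xs : List (Fin n)} {c : Fin n}
            (c∉xs : c ∉ xs) (mixed : Mixed w xs) where

  open VariantsOf w

  z : Bool
  z = lookup w c

  Moved : List (Fin n) → Pred (Subset n)
  Moved ys u = ∃ λ x → x ∈ ys × Side x c z u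

  moved-∈-Ψ : ∀ {x P u} → x ∈ xs → Variants w xs ⊆ P →
              Variants w (c ∷ xs) u → Side x c z u → Ψ c x z P u
  moved-∈-Ψ {x} {u = u} x∈xs base var moved =
    inj₂ (swap c x u , (base {swap c x u} back , swap-side⁻ moved) , swap-involutive c x u)
    where
    back : Variants w xs (swap c x u)
    back = variants-narrow c∉xs (variants-swap {u = u} (here refl) (there x∈xs) var)
                           (trans (lookup-swap-a c x u) (Side.lookup-a moved))

  grow-along : ∀ ys → (∀ {x} → x ∈ ys → x ∈ xs) → ∀ {P} →
               Variants w xs ⊆ P → P ⊆ Variants w (c ∷ xs) → Variants w (c ∷ xs) ⊆ P ∪ Moved ys →
               Reaches (Variants w (c ∷ xs)) P
  grow-along [] _ {P} _ _ cover = done λ var → absorb (cover var)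
    where
    absorb : ∀ {u} → (P ∪ Moved []) u → P u
    absorb (inj₁ Pu) = Pu
    absorb (inj₂ (_ , () , _))
  grow-along (x ∷ ys) ys⊆xs {P} base P⊆var cover =
    step-via c x z A∪F B∪F extend (grow-along ys (ys⊆xs ∘ there) (inj₁ ∘ base) P′⊆var cover′)
    where
    x∈xs = ys⊆xs (here refl)
    P′ = P ∪ (Variants w (c ∷ xs) ∩ Side x c z)
    A∪F : Satisfiable (P ∩ (Side c x z ∪ Balanced c x))
    A∪F = w , base variants-self , side-or-balanced c x w refl
    B∪F : Satisfiable (P ∩ (Side x c z ∪ Balanced c x))
    B∪F with mixed-witness mixed x∈xs z
    ... | u , var , ux≡z = u , base var , inj₂ (trans (Variants.agrees var c c∉xs) (sym ux≡z))
    extend : P′ ⊆ Ψ c x z P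
    extend (inj₂ (var , moved)) = moved-∈-Ψ x∈xs base var moved
    extend {u} (inj₁ Pu) with side-trichotomy c x z u
    ... | inj₁ A          = inj₁ (Pu , inj₁ A)
    ... | inj₂ (inj₁ B)   = moved-∈-Ψ x∈xs base (P⊆var Pu) B
    ... | inj₂ (inj₂ F)   = inj₁ (Pu , inj₂ F)
    P′⊆var : P′ ⊆ Variants w (c ∷ xs)
    P′⊆var (inj₁ Pu)        = P⊆var Pu
    P′⊆var (inj₂ (var , _)) = var
    cover′ : Variants w (c ∷ xs) ⊆ P′ ∪ Moved ys
    cover′ var with cover var
    ... | inj₁ Pu                            = inj₁ (inj₁ Pu)
    ... | inj₂ (_ , here refl , moved)       = inj₁ (inj₂ (var , moved))
    ... | inj₂ (x′ , there x′∈ys , moved)    = inj₂ (x′ , x′∈ys , moved)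

  grow : Reaches (Variants w (c ∷ xs)) (Variants w xs)
  grow = grow-along xs id id (variants-mono there) cover
    where
    cover : Variants w (c ∷ xs) ⊆ Variants w xs ∪ Moved xs
    cover {u} var with lookup u c ≟ᵇ z
    ... | yes uc≡z = inj₁ (variants-narrow c∉xs var uc≡z)
    ... | no uc≢z  = inj₂ (variants-compensate var uc≢z)

module _ {n : ℕ} (w : Subset n) where

  open VariantsOf w

  grow-coordinate : ∀ {xs} c → Mixed w xs → Reaches (Variants w (c ∷ xs)) (Variants w xs)
  grow-coordinate {xs} c mixed with any? (c ≟ᶠ_) xs
  ... | yes c∈xs = done (variants-mono λ { (here refl) → c∈xs ; (there i∈xs) → i∈xs })
  ... | no c∉xs  = Grow.grow w c∉xs mixed

  grow-coordinates : ∀ {xs} cs → Mixed w xs → Reaches (Variants w (cs ++ xs)) (Variants w xs)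
  grow-coordinates []       mixed = done id
  grow-coordinates (c ∷ cs) mixed =
    reaches-trans (grow-coordinates cs mixed) (grow-coordinate c mixed′)
    where
    mixed′ : Mixed w (cs ++ _)
    mixed′ z = let x , x∈xs , wx≡z = mixed z in x , ∈-++⁺ʳ cs x∈xs , wx≡z

  mixed-reaches-layer : ∀ {xs} → Mixed w xs → Reaches (Layer ∣ w ∣) (Variants w xs)
  mixed-reaches-layer mixed =
    reaches-trans (grow-coordinates (allFin n) mixed)
                  (done λ card → variant card λ i i∉ → ⊥-elim (i∉ (∈-++⁺ˡ (∈-allFin i))))

off-pair : ∀ {n} {a b i : Fin n} → i ≢ a → i ≢ b → i ∉ a ∷ b ∷ []
off-pair i≢a i≢b (here i≡a)         = i≢a i≡a
off-pair i≢a i≢b (there (here i≡b)) = i≢b i≡b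

module _ {n : ℕ} where

  differ-somewhere : ∀ {u v : Subset n} → u ≢ v → ∃ λ i → lookup u i ≢ lookup v i
  differ-somewhere {u} {v} u≢v = ¬∀⟶∃¬ n _ (λ i → lookup u i ≟ᵇ lookup v i) (u≢v ∘ lookup-ext)

  ≢⇒∃-∈-∉ : ∀ {s t : Subset n} → s ≢ t → ∣ s ∣ ≡ ∣ t ∣ →
            ∃ λ a → lookup s a ≡ true × lookup t a ≡ false
  ≢⇒∃-∈-∉ {s} {t} s≢t same
    with ¬∀⟶∃¬ n (λ i → lookup s i ≡ lookup t i ⊎ lookup s i ≡ false)
               (λ i → (lookup s i ≟ᵇ lookup t i) ⊎-dec (lookup s i ≟ᵇ false))
               (λ changes → let c , sc≢tc = differ-somewhere s≢t in
                            changes-only-to⇒∣∣≢ false {s} {t} changes c sc≢tc same)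
  ... | a , ¬changes = a , sa≡true , trans (¬-not λ ta≡sa → ¬changes (inj₁ (sym ta≡sa))) (cong not sa≡true)
    where
    sa≡true : lookup s a ≡ true
    sa≡true = ¬-not (¬changes ∘ inj₂)

  uniform : ∀ {a b : Fin n} {s u x} → Variants s (a ∷ b ∷ []) u →
            lookup u a ≡ x → lookup u b ≡ x → ChangesOnlyTo x u s
  uniform {a} {b} (variant _ agree) ua ub i with position a b i
  ... | at-a              = inj₂ ua
  ... | at-b              = inj₂ ub
  ... | elsewhere i≢a i≢b = inj₁ (agree i (off-pair i≢a i≢b))

  pair-variants : ∀ {a b : Fin n} {s u} → Side a b true s → Variants s (a ∷ b ∷ []) u →
                  s ≡ u ⊎ swap a b s ≡ u
  pair-variants {a} {b} {s} {u} (sided sa sb) var@(variant same agree)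
    with lookup u a in ua | lookup u b in ub
  ... | true  | false = inj₁ (lookup-ext λ i → at (position a b i))
    where
    at : ∀ {i} → Position a b i → lookup s i ≡ lookup u i
    at at-a                = trans sa (sym ua)
    at at-b                = trans sb (sym ub)
    at (elsewhere i≢a i≢b) = sym (agree _ (off-pair i≢a i≢b))
  ... | false | true  = inj₂ (lookup-ext λ i → at (position a b i))
    where
    at : ∀ {i} → Position a b i → lookup (swap a b s) i ≡ lookup u i
    at at-a                = trans (lookup-swap-a a b s) (trans sb (sym ua))
    at at-b                = trans (lookup-swap-b a b s) (trans sa (sym ub))
    at (elsewhere i≢a i≢b) = trans (lookup-swap-≢ a b s i≢a i≢b) (sym (agree _ (off-pair i≢a i≢b)))
  ... | true  | true  =
    ⊥-elim (changes-only-to⇒∣∣≢ true  {u} {s} (uniform var ua ub) b (λ e → not-¬ sb (trans (sym e) ub)) same)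
  ... | false | false =
    ⊥-elim (changes-only-to⇒∣∣≢ false {u} {s} (uniform var ua ub) a (λ e → not-¬ sa (trans (sym e) ua)) same)

  pair-reaches-layer : ∀ {s t : Subset n} → s ≢ t → ∣ s ∣ ≡ ∣ t ∣ →
                       Reaches (Layer ∣ s ∣) (｛ s ｝ ∪ ｛ t ｝)
  pair-reaches-layer {s} {t} s≢t same with ≢⇒∃-∈-∉ s≢t same | ≢⇒∃-∈-∉ (s≢t ∘ sym) (sym same)
  ... | a , sa , ta | b , tb , sb =
    step-via a b true (s , inj₁ refl , inj₁ s-side) (t , inj₂ refl , inj₁ (sided tb ta)) extend
             (mixed-reaches-layer s mixed)
    where
    s-side : Side a b true s
    s-side = sided sa sb
    mixed : Mixed s (a ∷ b ∷ [])
    mixed true  = a , here refl , sa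
    mixed false = b , there (here refl) , sb
    extend : Variants s (a ∷ b ∷ []) ⊆ Ψ a b true (｛ s ｝ ∪ ｛ t ｝)
    extend var with pair-variants s-side var
    ... | inj₁ refl = inj₁ (inj₁ refl , inj₁ s-side)
    ... | inj₂ refl = inj₂ (s , (inj₁ refl , s-side) , refl)

side-⊈ : ∀ {n} {a b : Fin n} {z s t} → Side a b z s → Side b a z t → ¬ s Sub.⊆ t
side-⊈ {a = a} {z = true}  (sided sa _) (sided _ ta) s⊆t = not-¬ (⊆-to-lookup s⊆t a sa) ta
side-⊈ {b = b} {z = false} (sided _ sb) (sided tb _) s⊆t = not-¬ (⊆-to-lookup s⊆t b sb) tb

side-disjoint : ∀ {n} {a b : Fin n} {z u} → Side a b z u → Side b a z u → ⊥
side-disjoint (sided ua _) (sided _ ua′) = not-¬ ua ua′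

side-unbalanced : ∀ {n} {a b : Fin n} {z u} → Side a b z u → ¬ Balanced a b u
side-unbalanced (sided ua ub) ua≡ub = not-¬ (trans (sym ua≡ub) ua) ub

module Graph (ℓ k : ℕ) where

  Vertex : Set
  Vertex = HVert ℓ k

  carrier : Vertex → Subset k
  carrier (inj₁ S) = set S
  carrier (inj₂ T) = set T

  size : Fin 2 → ℕ
  size zero       = ℓ
  size (suc zero) = k ∸ ℓ

  ∣carrier∣ : ∀ {i} v → Part (H ℓ k) i v → ∣ carrier v ∣ ≡ size i
  ∣carrier∣ (inj₁ (kset s c)) refl = recompute (∣ s ∣ ≟ⁿ ℓ) c
  ∣carrier∣ (inj₂ (kset s c)) refl = recompute (∣ s ∣ ≟ⁿ (k ∸ ℓ)) c

  realize : ∀ i {u} → ∣ u ∣ ≡ size i → ∃ λ v → Part (H ℓ k) i v × carrier v ≡ u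
  realize zero       {u} c = inj₁ (kset u c) , refl , refl
  realize (suc zero) {u} c = inj₂ (kset u c) , refl , refl

  vertex-≡ : ∀ {u v} → HPart ℓ k u ≡ HPart ℓ k v → carrier u ≡ carrier v → u ≡ v
  vertex-≡ {inj₁ _} {inj₁ _} _ refl = refl
  vertex-≡ {inj₂ _} {inj₂ _} _ refl = refl

  kswap : ∀ {r} → Fin k → Fin k → KSet k r → KSet k r
  kswap a b (kset s c) = kset (swap a b s) (trans (∣swap∣ a b s) c)

  swap-vertex : Fin k → Fin k → Vertex → Vertex
  swap-vertex a b = Sum.map (kswap a b) (kswap a b)

  module _ (a b : Fin k) where

    carrier-swap : ∀ v → carrier (swap-vertex a b v) ≡ swap a b (carrier v)
    carrier-swap (inj₁ _) = refl
    carrier-swap (inj₂ _) = refl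

    part-swap : ∀ v → HPart ℓ k (swap-vertex a b v) ≡ HPart ℓ k v
    part-swap (inj₁ _) = refl
    part-swap (inj₂ _) = refl

    swap-vertex-involutive : ∀ v → swap-vertex a b (swap-vertex a b v) ≡ v
    swap-vertex-involutive (inj₁ (kset s _)) = vertex-≡ refl (swap-involutive a b s)
    swap-vertex-involutive (inj₂ (kset s _)) = vertex-≡ refl (swap-involutive a b s)

    balanced⇒fixed : ∀ v → Balanced a b (carrier v) → Fix (H ℓ k) (swap-vertex a b) v
    balanced⇒fixed v bal =
      vertex-≡ (part-swap v) (trans (carrier-swap v) (balanced⇒swap-fixed a b (carrier v) bal))

    fixed⇒balanced : ∀ v → Fix (H ℓ k) (swap-vertex a b) v → Balanced a b (carrier v)
    fixed⇒balanced v fixed =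
      swap-fixed⇒balanced a b (carrier v) (trans (sym (carrier-swap v)) (cong carrier fixed))

    swap-vertex-adjacency : ∀ u v → HAdj ℓ k u v → HAdj ℓ k (swap-vertex a b u) (swap-vertex a b v)
    swap-vertex-adjacency (inj₁ S) (inj₂ T) = swap-preserves-⊆ a b
    swap-vertex-adjacency (inj₂ T) (inj₁ S) = swap-preserves-⊆ a b

    swap-vertex-adjacency⁻ : ∀ u v → HAdj ℓ k (swap-vertex a b u) (swap-vertex a b v) → HAdj ℓ k u v
    swap-vertex-adjacency⁻ (inj₁ S) (inj₂ T) = swap-reflects-⊆ a b
    swap-vertex-adjacency⁻ (inj₂ T) (inj₁ S) = swap-reflects-⊆ a b

    nice : ∀ z → Nice (H ℓ k) (Side a b z ∘ carrier) (Side b a z ∘ carrier) (swap-vertex a b)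
    nice z = record
      { involutive = swap-vertex-involutive
      ; preservesE = λ u v → swap-vertex-adjacency u v , swap-vertex-adjacency⁻ u v
      ; cover      = cover
      ; disjAB     = λ _ → side-disjoint
      ; disjAF     = λ v A F → side-unbalanced A (fixed⇒balanced v F)
      ; disjBF     = λ v B F → side-unbalanced B (sym (fixed⇒balanced v F))
      ; separates  = separates
      ; imageAB    = λ v → (λ { (u , A , refl) → subst (Side b a z) (sym (carrier-swap u)) (swap-side A) })
                         , (λ B → swap-vertex a b v , subst (Side a b z) (sym (carrier-swap v)) (swap-side⁻ B)
                                , swap-vertex-involutive v)
      }
      where
      cover : ∀ v → Side a b z (carrier v) ⊎ Side b a z (carrier v) ⊎ Fix (H ℓ k) (swap-vertex a b) v
      cover v with side-trichotomy a b z (carrier v)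
      ... | inj₁ A          = inj₁ A
      ... | inj₂ (inj₁ B)   = inj₂ (inj₁ B)
      ... | inj₂ (inj₂ bal) = inj₂ (inj₂ (balanced⇒fixed v bal))
      separates : ∀ u v → Side a b z (carrier u) → Side b a z (carrier v) → ¬ HAdj ℓ k u v
      separates (inj₁ S) (inj₂ T) A B = side-⊈ A B
      separates (inj₂ T) (inj₁ S) A B = side-⊈ B A

  Lift : Fin 2 → Pred (Subset k) → Pred Vertex
  Lift i P v = Part (H ℓ k) i v × P (carrier v)

  -- The invariant P ⊆ Layer (size i) is what turns "ends in a family containing the
  -- layer" into "ends exactly in the part X_i".
  transfer : ∀ i {P} → Reaches (Layer (size i)) P → P ⊆ Layer (size i) →
             ∀ {R} → R ≐ Lift i P → ReachesPart (H ℓ k) i R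
  transfer i (done L⊆P) P⊆L R≐ =
    done λ v → proj₁ ∘ proj₁ (R≐ v) , λ pv → proj₂ (R≐ v) (pv , L⊆P (∣carrier∣ v pv))
  transfer i {P} (step a b z AF BF r) P⊆L {R} R≐ =
    step (Side a b z ∘ carrier) (Side b a z ∘ carrier) (swap-vertex a b) (nice a b z) admissible
         (transfer i r ΨP⊆L ψR≐)
    where
    into : ∀ {v} → R v → Lift i P v
    into {v} = proj₁ (R≐ v)

    back : ∀ {v} → Lift i P v → R v
    back {v} = proj₂ (R≐ v)

    lift : ∀ {w} → P w → ∃ λ v → R v × carrier v ≡ w
    lift {w} Pw with realize i {w} (P⊆L Pw)
    ... | v , pv , refl = v , back (pv , Pw) , refl

    meets : ∀ {Q} → Satisfiable (P ∩ (Q ∪ Balanced a b)) →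
            Satisfiable (R ∩ ((Q ∘ carrier) ∪ Fix (H ℓ k) (swap-vertex a b)))
    meets (w , Pw , QF) with lift Pw
    ... | v , Rv , refl = v , Rv , Sum.map₂ (balanced⇒fixed a b v) QF

    admissible : Admissible (H ℓ k) (Side a b z ∘ carrier) (Side b a z ∘ carrier) (swap-vertex a b) R
    admissible = record { samePart = i , λ _ → proj₁ ∘ into ; meetsAF = meets AF ; meetsBF = meets BF }

    ΨP⊆L : Ψ a b z P ⊆ Layer (size i)
    ΨP⊆L (inj₁ (Pw , _))                = P⊆L Pw
    ΨP⊆L (inj₂ (w , (Pw , _) , refl)) = trans (∣swap∣ a b w) (P⊆L Pw)

    ψR : Pred Vertex
    ψR = ψ (H ℓ k) (Side a b z ∘ carrier) (Side b a z ∘ carrier) (swap-vertex a b) R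

    ψR≐ : ψR ≐ Lift i (Ψ a b z P)
    ψR≐ v = to , from
      where
      to : ψR v → Lift i (Ψ a b z P) v
      to (inj₁ (Rv , AF)) = proj₁ (into Rv) , inj₁ (proj₂ (into Rv) , Sum.map₂ (fixed⇒balanced a b v) AF)
      to (inj₂ (u , (Ru , Au) , refl)) =
        trans (part-swap a b u) (proj₁ (into Ru)) ,
        inj₂ (carrier u , (proj₂ (into Ru) , Au) , sym (carrier-swap a b u))
      from : Lift i (Ψ a b z P) v → ψR v
      from (pv , inj₁ (Pv , AF)) = inj₁ (back (pv , Pv) , Sum.map₂ (balanced⇒fixed a b v) AF)
      from (pv , inj₂ (w , (Pw , Aw) , e)) with lift Pw
      ... | x , Rx , refl =
        inj₂ (x , (Rx , Aw) , vertex-≡ (trans (part-swap a b x) (trans (proj₁ (into Rx)) (sym pv)))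
                                      (trans (carrier-swap a b x) e))

  reflective-part : ∀ i x y → Part (H ℓ k) i x → Part (H ℓ k) i y → x ≢ y →
                    ReachesPart (H ℓ k) i (Pair (H ℓ k) x y)
  reflective-part i x y px py x≢y = transfer i reaches pair⊆layer pair≐
    where
    reaches : Reaches (Layer (size i)) (｛ carrier x ｝ ∪ ｛ carrier y ｝)
    reaches = subst (λ r → Reaches (Layer r) _) (∣carrier∣ x px)
                    (pair-reaches-layer (x≢y ∘ vertex-≡ (trans px (sym py)))
                                        (trans (∣carrier∣ x px) (sym (∣carrier∣ y py))))
    pair⊆layer : ｛ carrier x ｝ ∪ ｛ carrier y ｝ ⊆ Layer (size i)
    pair⊆layer (inj₁ refl) = ∣carrier∣ x px
    pair⊆layer (inj₂ refl) = ∣carrier∣ y py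
    pair≐ : Pair (H ℓ k) x y ≐ Lift i (｛ carrier x ｝ ∪ ｛ carrier y ｝)
    pair≐ v = (λ { (inj₁ refl) → px , inj₁ refl ; (inj₂ refl) → py , inj₂ refl })
            , (λ { (pv , inj₁ e) → inj₁ (vertex-≡ (trans pv (sym px)) (sym e))
                 ; (pv , inj₂ e) → inj₂ (vertex-≡ (trans pv (sym py)) (sym e)) })

_◅◅_ : ∀ {G : BipGraph} {u v w} → Walk G u v → Walk G v w → Walk G u w
here      ◅◅ q = q
there e p ◅◅ q = there e (p ◅◅ q)

module Connectivity (ℓ k : ℕ) (1≤ℓ : 1 ≤ ℓ) (2ℓ<k : 2 * ℓ < k) where

  open Graph ℓ k

  reverse : ∀ {u v} → Walk (H ℓ k) u v → Walk (H ℓ k) v u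
  reverse here = here
  reverse (there {inj₁ _} {inj₂ _} e p) = reverse p ◅◅ there (λ {i} → e {i}) here
  reverse (there {inj₂ _} {inj₁ _} e p) = reverse p ◅◅ there (λ {i} → e {i}) here

  via : ∀ {S S′ : KSet k ℓ} (T : KSet k (k ∸ ℓ)) → set S Sub.⊆ set T → set S′ Sub.⊆ set T →
        Walk (H ℓ k) (inj₁ S) (inj₁ S′)
  via T S⊆T S′⊆T = there {w = inj₂ T} (λ {i} → S⊆T {i}) (there (λ {i} → S′⊆T {i}) here)

  ℓ<k∸ℓ : ℓ < k ∸ ℓ
  ℓ<k∸ℓ = m+n≤o⇒m≤o∸n (suc ℓ) (subst (λ m → suc (ℓ + m) ≤ k) (+-identityʳ ℓ) 2ℓ<k)

  walk-swap : ∀ {a b z u} → Side a b z u → (c : ∣ u ∣ ≡ ℓ) →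
              Walk (H ℓ k) (inj₁ (kset u c)) (inj₁ (kset (swap a b u) (trans (∣swap∣ a b u) c)))
  walk-swap {a} {b} {true} {u} (sided ua ub) c =
    let T , insert⊆T , _ , ∣T∣ = sandwich (k ∸ ℓ) Subₚ.⊆⊤ insert≤
                                   (subst (k ∸ ℓ ≤_) (sym (Subₚ.∣⊤∣≡n k)) (m∸n≤m k ℓ))
    in via (kset T ∣T∣) (Subₚ.⊆-trans (insert-⊇ u b) insert⊆T)
                        (Subₚ.⊆-trans (insert-⊇-swap a b ua) insert⊆T)
    where
    insert≤ : ∣ u [ b ]≔ true ∣ ≤ k ∸ ℓ
    insert≤ = subst (_≤ k ∸ ℓ) (sym (trans (∣insert∣ u ub) (cong suc c))) ℓ<k∸ℓ
  walk-swap {a} {b} {false} {u} (sided ua ub) c =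
    subst (λ w → (d : ∣ w ∣ ≡ ℓ) → Walk (H ℓ k) (inj₁ (kset u c)) (inj₁ (kset w d)))
          (swap-comm b a u) (λ _ → walk-swap (sided ub ua) c) (trans (∣swap∣ a b u) c)

  walk-to-layer : ∀ v → ∃ λ s → Σ (∣ s ∣ ≡ ℓ) λ c → Walk (H ℓ k) v (inj₁ (kset s c))
  walk-to-layer (inj₁ (kset s c)) = s , recompute (∣ s ∣ ≟ⁿ ℓ) c , here
  walk-to-layer (inj₂ (kset t c)) =
    let S , _ , S⊆t , ∣S∣ = sandwich ℓ Subₚ.⊥⊆ (subst (_≤ ℓ) (sym (Subₚ.∣⊥∣≡0 k)) z≤n) ℓ≤∣t∣
    in S , ∣S∣ , there (λ {i} → S⊆t {i}) here
    where
    ℓ≤∣t∣ : ℓ ≤ ∣ t ∣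
    ℓ≤∣t∣ = subst (ℓ ≤_) (sym (recompute (∣ t ∣ ≟ⁿ (k ∸ ℓ)) c)) (<⇒≤ ℓ<k∸ℓ)

  layer-connected : ∀ s (c : ∣ s ∣ ≡ ℓ) t (c′ : ∣ t ∣ ≡ ℓ) →
                    Walk (H ℓ k) (inj₁ (kset s c)) (inj₁ (kset t c′))
  layer-connected s c t c′ = reaches-⊆-closed reaches pair⊆Q closed (trans c′ (sym c)) c′
    where
    Q : Pred (Subset k)
    Q u = (d : ∣ u ∣ ≡ ℓ) → Walk (H ℓ k) (inj₁ (kset s c)) (inj₁ (kset u d))
    ∃a = ∃-member s (subst (0 <_) (sym c) 1≤ℓ)
    ∃b = ∃-non-member s (subst (_< k) (sym c) (≤-trans ℓ<k∸ℓ (m∸n≤m k ℓ)))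
    a = proj₁ ∃a
    b = proj₁ ∃b
    s-side : Side a b true s
    s-side = sided (proj₂ ∃a) (proj₂ ∃b)
    reaches : Reaches (Layer ∣ s ∣) (｛ s ｝ ∪ ｛ swap a b s ｝)
    reaches = pair-reaches-layer (λ s≡ → side-unbalanced s-side (swap-fixed⇒balanced a b s (sym s≡)))
                                 (sym (∣swap∣ a b s))
    pair⊆Q : ｛ s ｝ ∪ ｛ swap a b s ｝ ⊆ Q
    pair⊆Q (inj₁ refl) _ = here
    pair⊆Q (inj₂ refl) _ = walk-swap s-side c
    closed : SwapClosed Q
    closed a b z {u} side Qu d = Qu d′ ◅◅ walk-swap side d′
      where
      d′ = trans (sym (∣swap∣ a b u)) d

  connected : Connected (H ℓ k)
  connected u v =
    let s , c , u→s = walk-to-layer u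
        t , c′ , v→t = walk-to-layer v
    in u→s ◅◅ (layer-connected s c t c′ ◅◅ reverse v→t)

lemma2p19 : (ℓ k : ℕ) → 1 ≤ ℓ → 2 * ℓ < k → Reflective (H ℓ k)
lemma2p19 ℓ k 1≤ℓ 2ℓ<k = Connectivity.connected ℓ k 1≤ℓ 2ℓ<k , Graph.reflective-part ℓ k
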